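{- Let $G=(V,E)$ be a connected thick spider with spider partition $(S,C,R)$. Then $meg(G)=|S|+|R|$ if $|C|=2$, and $meg(G)=|Man(G)|=|V|$ otherwise.
   Context: For a graph $G=(V,E)$, an edge $e$ is monitored by a pair of vertices $a,b$ if every shortest $a$–$b$ path contains $e$; a set $S'\subseteq V$ monitors $e$ if some pair of vertices of $S'$ monitors $e$. An MEG set of $G$ is a set monitoring every edge; $meg(G)$ is the minimum size of an MEG set. A vertex is mandatory if it belongs to every MEG set, and $Man(G)$ is the set of mandatory vertices. A spider is a graph whose vertex set admits a partition into $S,C,R$ such that $C=\{c_1,\dots,c_l\}$ ($l\ge 2$) is a clique, $S=\{s_1,\dots,s_l\}$ is a stable set, and every vertex of $R$ is adjacent to every vertex of $C$ and to no vertex of $S$ (edges inside $R$ are unrestricted; $R$ may be empty). It is a thin spider if $N_C(s_i)=\{c_i\}$ for every $i$, and a thick spider if $N_C(s_i)=C\setminus\{c_i\}$ for every $i$. -}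

module Defs where

open import Data.Nat using (ℕ; zero; suc; _≤_)
open import Data.Fin using (Fin)
open import Data.Fin.Subset using (Subset; _∈_; _∉_; ∣_∣)
open import Data.Product using (Σ; ∃; ∃-syntax; _×_; _,_)
open import Data.Sum using (_⊎_)
open import Data.Empty using (⊥)
open import Relation.Nullary using (¬_)
open import Relation.Binary.PropositionalEquality using (_≡_; _≢_)
open import Relation.Binary.Definitions using (Decidable)
open import Function.Bundles using (_⇔_)

record Graph (n : ℕ) : Set₁ where
  field
    Adj    : Fin n → Fin n → Set
    Adj?   : Decidable Adj
    sym    : ∀ {u v} → Adj u v → Adj v u
    irrefl : ∀ {u} → ¬ Adj u u

module _ {n : ℕ} (G : Graph n) where
  open Graph G

  data Walk : Fin n → Fin n → Set where
    []  : ∀ {a} → Walk a a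
    _∷_ : ∀ {a b c} → Adj a b → Walk b c → Walk a c

  len : ∀ {a b} → Walk a b → ℕ
  len []      = zero
  len (_ ∷ w) = suc (len w)

  ContainsEdge : Fin n → Fin n → ∀ {a b} → Walk a b → Set
  ContainsEdge u v []                  = ⊥
  ContainsEdge u v (_∷_ {a} {b} _ w) =
    ((a ≡ u × b ≡ v) ⊎ (a ≡ v × b ≡ u)) ⊎ ContainsEdge u v w

  IsShortest : ∀ {a b} → Walk a b → Set
  IsShortest {a} {b} w = ∀ (w' : Walk a b) → len w ≤ len w'

  Connected : Set
  Connected = ∀ u v → Walk u v

  MonitoredBy : Fin n → Fin n → Fin n → Fin n → Set
  MonitoredBy a b u v = ∀ (w : Walk a b) → IsShortest w → ContainsEdge u v w

  Monitors : Subset n → Fin n → Fin n → Set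
  Monitors S' u v = ∃[ a ] ∃[ b ] (a ∈ S' × b ∈ S' × MonitoredBy a b u v)

  IsMEG : Subset n → Set
  IsMEG S' = ∀ u v → Adj u v → Monitors S' u v

  IsMegNumber : ℕ → Set
  IsMegNumber k = (∃[ S' ] (IsMEG S' × ∣ S' ∣ ≡ k)) × (∀ S' → IsMEG S' → k ≤ ∣ S' ∣)

  Mandatory : Fin n → Set
  Mandatory v = ∀ S' → IsMEG S' → v ∈ S'

  IsMan : Subset n → Set
  IsMan M = ∀ v → (v ∈ M) ⇔ Mandatory v

  record ThickSpider (l : ℕ) : Set where
    field
      two≤l   : 2 ≤ l
      s c     : Fin l → Fin n
      R       : Subset n
      s-inj   : ∀ i j → s i ≡ s j → i ≡ j
      c-inj   : ∀ i j → c i ≡ c j → i ≡ j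
      s≢c     : ∀ i j → s i ≢ c j
      s∉R     : ∀ i → s i ∉ R
      c∉R     : ∀ i → c i ∉ R
      cover   : ∀ v → (∃[ i ] v ≡ s i) ⊎ (∃[ i ] v ≡ c i) ⊎ v ∈ R
      C-clique  : ∀ i j → i ≢ j → Adj (c i) (c j)
      S-stable  : ∀ i j → ¬ Adj (s i) (s j)
      thick     : ∀ i j → Adj (s i) (c j) ⇔ (i ≢ j)
      R-C       : ∀ v j → v ∈ R → Adj v (c j)
      R-S       : ∀ v j → v ∈ R → ¬ Adj v (s j)

{-# OPTIONS --safe #-}
module Submission where

-- A vertex v with a neighbour u lies in every MEG set as soon as any two vertices other than v
-- are joined by a shortest path avoiding the edge vu, since the pair monitoring vu must then
-- contain v. Between vertices at distance at most two such a path exists whenever every induced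
-- path u–v–x closes to a 4-cycle u–v–x–m with m ≠ v.
-- In a thick spider every vertex is adjacent to all of C but at most one c_p, and s_k is the only
-- vertex besides c_k not adjacent to c_k. For |C| ≥ 3 this gives diameter two, and any v can use
-- u = c_k with k ≠ p, the induced path c_k–v–s_k closing through a third vertex of C: every
-- vertex is mandatory. For |C| = 2 the s_i are leaves and s_1, s_2 is the only pair at distance
-- three, joined only by s_1 c_2 c_1 s_2, whose inner vertices lie in C; for v ∉ C the 4-cycle
-- condition holds vacuously since v is not adjacent to s_k, so S ∪ R is mandatory. It also
-- monitors every edge: c_1c_2 through s_1, s_2, and c_i r through r and the leaf at c_i.

open import Defs
open import Data.Nat using (ℕ; suc; _+_; _≤_; z≤n; s≤s)
open import Data.Nat.Properties using (≤∧≢⇒<; m≤n⇒m≤1+n)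
open import Data.Fin using (Fin; zero; suc; punchIn; punchOut)
open import Data.Fin.Properties using (_≟_; punchInᵢ≢i; punchIn-injective; punchIn-punchOut)
open import Data.Fin.Subset using (Subset; ∣_∣; _∈_; _∉_; _∪_; ⁅_⁆; ⊤; inside; outside)
open import Data.Fin.Subset.Properties
  using (∈⊤; ∣⊤∣≡n; p⊆q⇒∣p∣≤∣q∣; x∈p∪q⁺; x∈p∪q⁻; x∈⁅x⁆; x∈⁅y⁆⇒x≡y; ∪-identityʳ)
open import Data.Vec.Base using ([]; _∷_; here; there)
open import Data.Product using (_×_; _,_; proj₁; proj₂; Σ; ∃-syntax)
open import Data.Sum as Sum using (_⊎_; inj₁; inj₂)
open import Data.Empty using (⊥-elim)
open import Function using (_∘_)
open import Function.Bundles using (mk⇔; Equivalence)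
open import Relation.Nullary using (¬_; yes; no)
open import Relation.Binary.PropositionalEquality using (_≡_; _≢_; refl; sym; trans; cong; subst)

private variable
  l : ℕ

avoid-one : 2 ≤ l → (p : Fin l) → ∃[ k ] k ≢ p
avoid-one (s≤s (s≤s _)) p = punchIn p zero , punchInᵢ≢i p zero

avoid-two : 3 ≤ l → (p q : Fin l) → ∃[ k ] (k ≢ p × k ≢ q)
avoid-two (s≤s 2≤l′) p q with p ≟ q
... | yes refl with avoid-one (m≤n⇒m≤1+n 2≤l′) p
...   | k , k≢p = k , k≢p , k≢p
avoid-two (s≤s 2≤l′) p q | no p≢q with avoid-one 2≤l′ (punchOut p≢q)
...   | k′ , k′≢q′ = punchIn p k′ , punchInᵢ≢i p k′ , λ k≡q →
  k′≢q′ (punchIn-injective p _ _ (trans k≡q (sym (punchIn-punchOut p≢q))))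

fin2-≢⇒≡ : {k p q : Fin 2} → k ≢ p → q ≢ p → k ≡ q
fin2-≢⇒≡ {zero}     {zero}     {_}        k≢p _   = ⊥-elim (k≢p refl)
fin2-≢⇒≡ {suc zero} {suc zero} {_}        k≢p _   = ⊥-elim (k≢p refl)
fin2-≢⇒≡ {_}        {zero}     {zero}     _   q≢p = ⊥-elim (q≢p refl)
fin2-≢⇒≡ {_}        {suc zero} {suc zero} _   q≢p = ⊥-elim (q≢p refl)
fin2-≢⇒≡ {zero}     {suc zero} {zero}     _   _   = refl
fin2-≢⇒≡ {suc zero} {zero}     {suc zero} _   _   = refl

∣p∪⁅x⁆∣≡1+∣p∣ : ∀ {m} (p : Subset m) {x : Fin m} → x ∉ p → ∣ p ∪ ⁅ x ⁆ ∣ ≡ suc ∣ p ∣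
∣p∪⁅x⁆∣≡1+∣p∣ (inside  ∷ p) {zero}  x∉p = ⊥-elim (x∉p here)
∣p∪⁅x⁆∣≡1+∣p∣ (outside ∷ p) {zero}  _   = cong (suc ∘ ∣_∣) (∪-identityʳ p)
∣p∪⁅x⁆∣≡1+∣p∣ (inside  ∷ p) {suc x} x∉p = cong suc (∣p∪⁅x⁆∣≡1+∣p∣ p (x∉p ∘ there))
∣p∪⁅x⁆∣≡1+∣p∣ (outside ∷ p) {suc x} x∉p = ∣p∪⁅x⁆∣≡1+∣p∣ p (x∉p ∘ there)

module _ {n : ℕ} (G : Graph n) where
  open Graph G renaming (sym to Adj-sym)

  private variable
    a b m u v x : Fin n
    T : Subset n

  adjacent⇒≢ : Adj u v → u ≢ v
  adjacent⇒≢ uv refl = irrefl uv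

  []-isShortest : IsShortest G ([] {a = a})
  []-isShortest _ = z≤n

  edge-isShortest : (ab : Adj a b) → IsShortest G (ab ∷ [])
  edge-isShortest ab []      = ⊥-elim (irrefl ab)
  edge-isShortest ab (_ ∷ _) = s≤s z≤n

  twoStep-isShortest : a ≢ b → ¬ Adj a b → (am : Adj a m) (mb : Adj m b) →
                       IsShortest G (am ∷ (mb ∷ []))
  twoStep-isShortest a≢b _   _ _ []             = ⊥-elim (a≢b refl)
  twoStep-isShortest _   ¬ab _ _ (ab ∷ [])      = ⊥-elim (¬ab ab)
  twoStep-isShortest _   _   _ _ (_ ∷ (_ ∷ _)) = s≤s (s≤s z≤n)

  containsEdge-sym : (w : Walk G a b) → ContainsEdge G u v w → ContainsEdge G v u w
  containsEdge-sym []      ()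
  containsEdge-sym (_ ∷ w) = Sum.map Sum.swap (containsEdge-sym w)

  Avoids : Fin n → Walk G a b → Set
  Avoids x ([] {a = a})     = a ≢ x
  Avoids x (_∷_ {a = a} _ w) = a ≢ x × Avoids x w

  avoids-start : (w : Walk G a b) → Avoids x w → a ≢ x
  avoids-start []      a≢x       = a≢x
  avoids-start (_ ∷ _) (a≢x , _) = a≢x

  avoids⇒¬containsEdge : (w : Walk G a b) → Avoids v w → ¬ ContainsEdge G v u w
  avoids⇒¬containsEdge []      _         ()
  avoids⇒¬containsEdge (_ ∷ _) (a≢v , _) (inj₁ (inj₁ (a≡v , _))) = a≢v a≡v
  avoids⇒¬containsEdge (_ ∷ w) (_ , w-avoids) (inj₁ (inj₂ (_ , b≡v))) = avoids-start w w-avoids b≡v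
  avoids⇒¬containsEdge (_ ∷ w) (_ , w-avoids) (inj₂ vu∈w) = avoids⇒¬containsEdge w w-avoids vu∈w

  avoids-end⇒¬containsEdge : (w : Walk G a b) → Avoids v w ⊎ Avoids u w → ¬ ContainsEdge G v u w
  avoids-end⇒¬containsEdge w (inj₁ avoids-v) = avoids⇒¬containsEdge w avoids-v
  avoids-end⇒¬containsEdge w (inj₂ avoids-u) = avoids⇒¬containsEdge w avoids-u ∘ containsEdge-sym w

  monitoredBy-ends : Adj u v → MonitoredBy G u v u v
  monitoredBy-ends uv []            _        = ⊥-elim (irrefl uv)
  monitoredBy-ends uv (_ ∷ [])      _        = inj₁ (inj₁ (refl , refl))
  monitoredBy-ends uv (_ ∷ (_ ∷ _)) shortest with shortest (uv ∷ [])
  ... | s≤s ()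

  monitors-sym : Monitors G T u v → Monitors G T v u
  monitors-sym (a , b , a∈T , b∈T , mon) =
    a , b , a∈T , b∈T , λ w shortest → containsEdge-sym w (mon w shortest)

  leaf-edge-monitored : (∀ {x} → Adj a x → x ≡ u) → b ≢ a → MonitoredBy G a b a u
  leaf-edge-monitored _    b≢a []       _ = b≢a refl
  leaf-edge-monitored leaf _   (ax ∷ _) _ = inj₁ (inj₁ (refl , leaf ax))

  isMegNumber-of-mandatory : IsMEG G T → (∀ {v} → v ∈ T → Mandatory G v) → IsMegNumber G ∣ T ∣
  isMegNumber-of-mandatory {T} T-meg T-mandatory =
    (T , T-meg , refl) , λ S′ S′-meg → p⊆q⇒∣p∣≤∣q∣ (λ v∈T → T-mandatory v∈T S′ S′-meg)

  all-mandatory⇒meg≡∣Man∣≡n : (∀ v → Mandatory G v) →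
                              IsMegNumber G n × ∃[ M ] (IsMan G M × ∣ M ∣ ≡ n)
  all-mandatory⇒meg≡∣Man∣≡n mandatory =
      subst (IsMegNumber G) (∣⊤∣≡n n) (isMegNumber-of-mandatory ⊤-isMEG (λ {v} _ → mandatory v))
    , ⊤ , (λ v → mk⇔ (λ _ → mandatory v) (λ _ → ∈⊤)) , ∣⊤∣≡n n
    where
      ⊤-isMEG : IsMEG G ⊤
      ⊤-isMEG u v uv = u , v , ∈⊤ , ∈⊤ , monitoredBy-ends uv

  Bypass : Fin n → Fin n → Fin n → Fin n → Set
  Bypass v u a b = Σ (Walk G a b) λ w → IsShortest G w × ¬ ContainsEdge G v u w

  mandatory-if-bypassed : Adj v u → (∀ a b → a ≢ v → b ≢ v → Bypass v u a b) → Mandatory G v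
  mandatory-if-bypassed {v} vu bypass S′ S′-meg with S′-meg _ _ vu
  ... | a , b , a∈S′ , b∈S′ , mon with a ≟ v | b ≟ v
  ... | yes refl | _        = a∈S′
  ... | no _     | yes refl = b∈S′
  ... | no a≢v   | no b≢v with bypass a b a≢v b≢v
  ... | w , shortest , ¬vu = ⊥-elim (¬vu (mon w shortest))

  WithinTwo : Fin n → Fin n → Set
  WithinTwo a b = a ≢ b → ¬ Adj a b → ∃[ m ] (Adj a m × Adj m b)

  withinTwo-sym : WithinTwo a b → WithinTwo b a
  withinTwo-sym withinTwo b≢a ¬ba with withinTwo (b≢a ∘ sym) (¬ba ∘ Adj-sym)
  ... | m , am , mb = m , Adj-sym mb , Adj-sym am

  Induced2PathsIn4Cycles : Fin n → Fin n → Set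
  Induced2PathsIn4Cycles v u =
    ∀ {x} → Adj v x → x ≢ u → ¬ Adj u x → ∃[ m ] (m ≢ v × Adj u m × Adj m x)

  bypass-by-twoStep : a ≢ b → ¬ Adj a b → (am : Adj a m) (mb : Adj m b) →
                   Avoids v (am ∷ (mb ∷ [])) ⊎ Avoids u (am ∷ (mb ∷ [])) → Bypass v u a b
  bypass-by-twoStep a≢b ¬ab am mb avoids =
      am ∷ (mb ∷ []) , twoStep-isShortest a≢b ¬ab am mb
    , avoids-end⇒¬containsEdge (am ∷ (mb ∷ [])) avoids

  bypass-at-distance-two : Adj v u → Induced2PathsIn4Cycles v u → a ≢ v → b ≢ v →
                           a ≢ b → ¬ Adj a b → Adj a m → Adj m b → Bypass v u a b
  bypass-at-distance-two {v} {u} {a} {b} {m} vu in4Cycles a≢v b≢v a≢b ¬ab am mb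
    with m ≟ v | a ≟ u | b ≟ u
  ... | no m≢v   | _        | _ =
    bypass-by-twoStep a≢b ¬ab am mb (inj₁ (a≢v , m≢v , b≢v))
  ... | yes refl | yes refl | _ with in4Cycles mb (a≢b ∘ sym) ¬ab
  ...   | m′ , m′≢v , am′ , m′b =
    bypass-by-twoStep a≢b ¬ab am′ m′b (inj₁ (a≢v , m′≢v , b≢v))
  bypass-at-distance-two vu in4Cycles a≢v b≢v a≢b ¬ab am mb | yes refl | _ | yes refl
    with in4Cycles (Adj-sym am) a≢b (¬ab ∘ Adj-sym)
  ...   | m′ , m′≢v , bm′ , m′a =
    bypass-by-twoStep a≢b ¬ab (Adj-sym m′a) (Adj-sym bm′) (inj₁ (a≢v , m′≢v , b≢v))
  bypass-at-distance-two vu in4Cycles a≢v b≢v a≢b ¬ab am mb | yes refl | no a≢u | no b≢u =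
    bypass-by-twoStep a≢b ¬ab am mb (inj₂ (a≢u , adjacent⇒≢ vu , b≢u))

  bypass-within-two : Adj v u → Induced2PathsIn4Cycles v u → a ≢ v → b ≢ v → WithinTwo a b →
                      Bypass v u a b
  bypass-within-two {a = a} {b = b} vu in4Cycles a≢v b≢v withinTwo with a ≟ b | Adj? a b
  ... | yes refl | _      = [] , []-isShortest , λ ()
  ... | no _     | yes ab =
    ab ∷ [] , edge-isShortest ab , avoids⇒¬containsEdge (ab ∷ []) (a≢v , b≢v)
  ... | no a≢b   | no ¬ab with withinTwo a≢b ¬ab
  ...   | _ , am , mb = bypass-at-distance-two vu in4Cycles a≢v b≢v a≢b ¬ab am mb

module ThickSpiderProperties {n l : ℕ} {G : Graph n} (sp : ThickSpider G l) where
  open Graph G renaming (sym to Adj-sym)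
  open ThickSpider sp

  private variable
    p q k : Fin l
    v x : Fin n

  another-index : (p : Fin l) → ∃[ k ] k ≢ p
  another-index = avoid-one two≤l

  s-c-adjacent : p ≢ q → Adj (s p) (c q)
  s-c-adjacent {p} {q} = Equivalence.from (thick p q)

  s-c-nonadjacent : ¬ Adj (s p) (c p)
  s-c-nonadjacent {p} sc = Equivalence.to (thick p p) sc refl

  R-≢-c : v ∈ R → v ≢ c k
  R-≢-c v∈R refl = c∉R _ v∈R

  c-adjacent-but-one : ∀ v → ∃[ p ] (∀ k → k ≢ p → Adj v (c k))
  c-adjacent-but-one v with cover v | two≤l
  ... | inj₁ (p , refl)        | _     = p , λ k k≢p → s-c-adjacent (k≢p ∘ sym)
  ... | inj₂ (inj₁ (p , refl)) | _     = p , λ k k≢p → C-clique p k (k≢p ∘ sym)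
  ... | inj₂ (inj₂ v∈R)        | s≤s _ = zero , λ k _ → R-C v k v∈R

  non-neighbour-of-c : x ≢ c k → ¬ Adj (c k) x → x ≡ s k
  non-neighbour-of-c {x} {k} x≢ck ¬ckx with cover x
  ... | inj₁ (p , refl) with p ≟ k
  ...   | yes refl = refl
  ...   | no p≢k   = ⊥-elim (¬ckx (Adj-sym (s-c-adjacent p≢k)))
  non-neighbour-of-c {k = k} x≢ck ¬ckx | inj₂ (inj₁ (p , refl)) with p ≟ k
  ...   | yes refl = ⊥-elim (x≢ck refl)
  ...   | no p≢k   = ⊥-elim (¬ckx (C-clique k p (p≢k ∘ sym)))
  non-neighbour-of-c {x} {k} x≢ck ¬ckx | inj₂ (inj₂ x∈R) = ⊥-elim (¬ckx (Adj-sym (R-C x k x∈R)))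

  in4Cycles-if-¬adjacent-to-s : ¬ Adj v (s k) → Induced2PathsIn4Cycles G v (c k)
  in4Cycles-if-¬adjacent-to-s ¬vs vx x≢ck ¬ckx with non-neighbour-of-c x≢ck ¬ckx
  ... | refl = ⊥-elim (¬vs vx)

  in4Cycles-if-3≤l : 3 ≤ l → (∀ j → j ≢ p → Adj v (c j)) → k ≢ p → Induced2PathsIn4Cycles G v (c k)
  in4Cycles-if-3≤l {p} {v} {k} 3≤l v~c k≢p vx x≢ck ¬ckx with non-neighbour-of-c x≢ck ¬ckx
  ... | refl with avoid-two 3≤l k p
  ... | j , j≢k , j≢p = c j , cj≢v , C-clique k j (j≢k ∘ sym) , Adj-sym (s-c-adjacent (j≢k ∘ sym))
    where
      cj≢v : c j ≢ v
      cj≢v cj≡v = irrefl (subst (Adj v) cj≡v (v~c j j≢p))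

  withinTwo-C∪R : ∀ a {b} → (∃[ q ] b ≡ c q) ⊎ b ∈ R → WithinTwo G a b
  withinTwo-C∪R a b∈C∪R a≢b ¬ab with c-adjacent-but-one a
  ... | p , a~c with another-index p | b∈C∪R
  ... | k , k≢p | inj₂ b∈R = c k , a~c k k≢p , Adj-sym (R-C _ k b∈R)
  ... | k , k≢p | inj₁ (q , refl) with q ≟ p
  ...   | no q≢p   = ⊥-elim (¬ab (a~c q q≢p))
  ...   | yes refl = c k , a~c k k≢p , C-clique k q k≢p

  withinTwo-or-s-pair : ∀ a b → WithinTwo G a b ⊎ ∃[ p ] ∃[ q ] (p ≢ q × a ≡ s p × b ≡ s q)
  withinTwo-or-s-pair a b with cover a | cover b
  ... | inj₁ (p , refl) | inj₁ (q , refl) with p ≟ q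
  ...   | yes refl = inj₁ λ s≢s → ⊥-elim (s≢s refl)
  ...   | no p≢q   = inj₂ (p , q , p≢q , refl , refl)
  withinTwo-or-s-pair a b | _              | inj₂ b∈C∪R = inj₁ (withinTwo-C∪R a b∈C∪R)
  withinTwo-or-s-pair a b | inj₂ a∈C∪R     | inj₁ _     =
    inj₁ (withinTwo-sym G (withinTwo-C∪R b a∈C∪R))

  withinTwo-if-3≤l : 3 ≤ l → ∀ a b → WithinTwo G a b
  withinTwo-if-3≤l 3≤l a b _ _ with c-adjacent-but-one a | c-adjacent-but-one b
  ... | p , a~c | q , b~c with avoid-two 3≤l p q
  ... | k , k≢p , k≢q = c k , a~c k k≢p , Adj-sym (b~c k k≢q)

  all-mandatory-if-3≤l : 3 ≤ l → ∀ v → Mandatory G v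
  all-mandatory-if-3≤l 3≤l v with c-adjacent-but-one v
  ... | p , v~c with another-index p
  ... | k , k≢p = mandatory-if-bypassed G (v~c k k≢p) λ a b a≢v b≢v →
    bypass-within-two G (v~c k k≢p) (in4Cycles-if-3≤l 3≤l v~c k≢p) a≢v b≢v
      (withinTwo-if-3≤l 3≤l a b)

module TwoLeggedThickSpider {n : ℕ} {G : Graph n} (sp : ThickSpider G 2) where
  open Graph G renaming (sym to Adj-sym)
  open ThickSpider sp
  open ThickSpiderProperties sp

  private variable
    p q : Fin 2
    a b v x : Fin n

  s-leaf : p ≢ q → Adj (s p) x → x ≡ c q
  s-leaf {p} {q} {x} p≢q sx with cover x
  ... | inj₁ (r , refl)        = ⊥-elim (S-stable p r sx)
  ... | inj₂ (inj₁ (k , refl)) = cong c (fin2-≢⇒≡ (Equivalence.to (thick p k) sx ∘ sym) (p≢q ∘ sym))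
  ... | inj₂ (inj₂ x∈R)        = ⊥-elim (R-S x p x∈R (Adj-sym sx))

  s-pair-walk : p ≢ q → Walk G (s p) (s q)
  s-pair-walk p≢q =
    s-c-adjacent p≢q ∷ (C-clique _ _ (p≢q ∘ sym) ∷ (Adj-sym (s-c-adjacent (p≢q ∘ sym)) ∷ []))

  s-pair-walk-shape : p ≢ q → a ≡ s p → b ≡ s q → (w : Walk G a b) →
                      3 ≤ len G w × (len G w ≤ 3 → ContainsEdge G (c q) (c p) w)
  s-pair-walk-shape {p} {q} p≢q refl b≡sq [] = ⊥-elim (p≢q (s-inj p q b≡sq))
  s-pair-walk-shape {p} {q} p≢q refl refl (sx ∷ []) = ⊥-elim (S-stable p q sx)
  s-pair-walk-shape p≢q refl refl (sx ∷ (xs ∷ [])) with s-leaf p≢q sx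
  ... | refl = ⊥-elim (s-c-nonadjacent (Adj-sym xs))
  s-pair-walk-shape p≢q refl refl (sx ∷ (_ ∷ (ys ∷ [])))
    with s-leaf p≢q sx | s-leaf (p≢q ∘ sym) (Adj-sym ys)
  ... | refl | refl = s≤s (s≤s (s≤s z≤n)) , λ _ → inj₂ (inj₁ (inj₁ (refl , refl)))
  s-pair-walk-shape _ _ _ (_ ∷ (_ ∷ (_ ∷ (_ ∷ _)))) =
    s≤s (s≤s (s≤s z≤n)) , λ { (s≤s (s≤s (s≤s ()))) }

  s-pair-walk-isShortest : (p≢q : p ≢ q) → IsShortest G (s-pair-walk p≢q)
  s-pair-walk-isShortest p≢q w = proj₁ (s-pair-walk-shape p≢q refl refl w)

  s-R-walk-shape : p ≢ q → b ∈ R → a ≡ s p → (w : Walk G a b) →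
                   len G w ≤ 2 → ContainsEdge G (c q) b w
  s-R-walk-shape _ b∈R refl [] _ = s∉R _ b∈R
  s-R-walk-shape {p} {b = b} _ b∈R refl (sb ∷ []) _ = ⊥-elim (R-S b p b∈R (Adj-sym sb))
  s-R-walk-shape p≢q _ refl (sx ∷ (_ ∷ [])) _ with s-leaf p≢q sx
  ... | refl = inj₂ (inj₁ (inj₁ (refl , refl)))
  s-R-walk-shape _ _ _ (_ ∷ (_ ∷ (_ ∷ _))) (s≤s (s≤s ()))

  mandatory-outside-C : Adj v (c q) → (∀ j → v ≢ c j) → (∀ j → ¬ Adj v (s j)) → Mandatory G v
  mandatory-outside-C {v} {q} vc v∉C ¬v~S = mandatory-if-bypassed G vc bypass
    where
      bypass : ∀ a b → a ≢ v → b ≢ v → Bypass G v (c q) a b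
      bypass a b a≢v b≢v with withinTwo-or-s-pair a b
      ... | inj₁ withinTwo =
        bypass-within-two G vc (in4Cycles-if-¬adjacent-to-s (¬v~S q)) a≢v b≢v withinTwo
      ... | inj₂ (p , p′ , p≢p′ , refl , refl) =
          s-pair-walk p≢p′ , s-pair-walk-isShortest p≢p′
        , avoids⇒¬containsEdge G (s-pair-walk p≢p′) (a≢v , v∉C p′ ∘ sym , v∉C p ∘ sym , b≢v)

  S∪R : Subset n
  S∪R = (R ∪ ⁅ s zero ⁆) ∪ ⁅ s (suc zero) ⁆

  s∈S∪R : ∀ p → s p ∈ S∪R
  s∈S∪R zero       = x∈p∪q⁺ (inj₁ (x∈p∪q⁺ (inj₂ (x∈⁅x⁆ _))))
  s∈S∪R (suc zero) = x∈p∪q⁺ (inj₂ (x∈⁅x⁆ _))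

  R⊆S∪R : v ∈ R → v ∈ S∪R
  R⊆S∪R v∈R = x∈p∪q⁺ (inj₁ (x∈p∪q⁺ (inj₁ v∈R)))

  ∣S∪R∣≡2+∣R∣ : ∣ S∪R ∣ ≡ 2 + ∣ R ∣
  ∣S∪R∣≡2+∣R∣ =
    trans (∣p∪⁅x⁆∣≡1+∣p∣ (R ∪ ⁅ s zero ⁆) s₁∉) (cong suc (∣p∪⁅x⁆∣≡1+∣p∣ R (s∉R zero)))
    where
      s₁∉ : s (suc zero) ∉ R ∪ ⁅ s zero ⁆
      s₁∉ s₁∈ with x∈p∪q⁻ R ⁅ s zero ⁆ s₁∈
      ... | inj₁ s₁∈R = s∉R (suc zero) s₁∈R
      ... | inj₂ s₁≡s₀ with s-inj (suc zero) zero (x∈⁅y⁆⇒x≡y _ s₁≡s₀)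
      ... | ()

  s-mandatory : ∀ p → Mandatory G (s p)
  s-mandatory p with another-index p
  ... | q , q≢p = mandatory-outside-C (s-c-adjacent (q≢p ∘ sym)) (s≢c p) (S-stable p)

  R-mandatory : v ∈ R → Mandatory G v
  R-mandatory {v} v∈R = mandatory-outside-C (R-C v zero v∈R) (λ _ → R-≢-c v∈R) (λ j → R-S v j v∈R)

  S∪R-mandatory : v ∈ S∪R → Mandatory G v
  S∪R-mandatory v∈S∪R with x∈p∪q⁻ (R ∪ ⁅ s zero ⁆) _ v∈S∪R
  ... | inj₂ v∈⁅s₁⁆ rewrite x∈⁅y⁆⇒x≡y _ v∈⁅s₁⁆ = s-mandatory (suc zero)
  ... | inj₁ v∈R∪⁅s₀⁆ with x∈p∪q⁻ R _ v∈R∪⁅s₀⁆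
  ...   | inj₁ v∈R = R-mandatory v∈R
  ...   | inj₂ v∈⁅s₀⁆ rewrite x∈⁅y⁆⇒x≡y _ v∈⁅s₀⁆ = s-mandatory zero

  s-c-monitored : Adj (s p) (c q) → Monitors G S∪R (s p) (c q)
  s-c-monitored {p} {q} sc =
    s p , s q , s∈S∪R p , s∈S∪R q , leaf-edge-monitored G (s-leaf p≢q) (p≢q ∘ sym ∘ s-inj q p)
    where
      p≢q : p ≢ q
      p≢q = Equivalence.to (thick p q) sc

  c-c-monitored : Adj (c p) (c q) → Monitors G S∪R (c p) (c q)
  c-c-monitored {p} {q} cc =
    s q , s p , s∈S∪R q , s∈S∪R p ,
    λ w shortest → proj₂ (s-pair-walk-shape q≢p refl refl w) (shortest (s-pair-walk q≢p))
    where
      q≢p : q ≢ p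
      q≢p = adjacent⇒≢ G cc ∘ cong c ∘ sym

  c-R-monitored : v ∈ R → Monitors G S∪R (c q) v
  c-R-monitored {v} {q} v∈R with another-index q
  ... | p , p≢q = s p , v , s∈S∪R p , R⊆S∪R v∈R ,
    λ w shortest → s-R-walk-shape p≢q v∈R refl w
      (shortest (s-c-adjacent p≢q ∷ (Adj-sym (R-C v q v∈R) ∷ [])))

  S∪R-isMEG : IsMEG G S∪R
  S∪R-isMEG u v uv with cover u | cover v
  ... | inj₁ (p , refl)        | inj₁ (q , refl)        = ⊥-elim (S-stable p q uv)
  ... | inj₁ (p , refl)        | inj₂ (inj₁ (q , refl)) = s-c-monitored uv
  ... | inj₁ (p , refl)        | inj₂ (inj₂ v∈R)        = ⊥-elim (R-S v p v∈R (Adj-sym uv))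
  ... | inj₂ (inj₁ (q , refl)) | inj₁ (p , refl)        =
    monitors-sym G (s-c-monitored (Adj-sym uv))
  ... | inj₂ (inj₁ (p , refl)) | inj₂ (inj₁ (q , refl)) = c-c-monitored uv
  ... | inj₂ (inj₁ (q , refl)) | inj₂ (inj₂ v∈R)        = c-R-monitored v∈R
  ... | inj₂ (inj₂ u∈R)        | inj₁ (p , refl)        = ⊥-elim (R-S u p u∈R uv)
  ... | inj₂ (inj₂ u∈R)        | inj₂ (inj₁ (q , refl)) = monitors-sym G (c-R-monitored u∈R)
  ... | inj₂ (inj₂ u∈R)        | inj₂ (inj₂ v∈R)        =
    u , v , R⊆S∪R u∈R , R⊆S∪R v∈R , monitoredBy-ends G uv

  meg≡2+∣R∣ : IsMegNumber G (2 + ∣ R ∣)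
  meg≡2+∣R∣ = subst (IsMegNumber G) ∣S∪R∣≡2+∣R∣ (isMegNumber-of-mandatory G S∪R-isMEG S∪R-mandatory)

mainTheorem3 : ∀ {n l : ℕ} (G : Graph n) (sp : ThickSpider G l) → Connected G →
    (l ≡ 2 → IsMegNumber G (l + ∣ ThickSpider.R sp ∣))
    × (l ≢ 2 → IsMegNumber G n × (∃[ M ] (IsMan G M × ∣ M ∣ ≡ n)))
mainTheorem3 G sp _ =
    (λ { refl → TwoLeggedThickSpider.meg≡2+∣R∣ sp })
  , λ l≢2 → all-mandatory⇒meg≡∣Man∣≡n G (all-mandatory-if-3≤l (≤∧≢⇒< two≤l (l≢2 ∘ sym)))
  where open ThickSpiderProperties sp
        open ThickSpider sp using (two≤l)
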